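{- Let $\eta\geq1$ be a countable ordinal. Then neither $(2^\omega,2^\omega,\mathbb{N}^\eta_0,\mathbb{N}^\eta_1)\sqsubseteq(2^\omega,2^\omega,\mathbb{B}^\eta_0,\mathbb{B}^\eta_1)$ via a square map, nor $(2^\omega,2^\omega,\mathbb{B}^\eta_0,\mathbb{B}^\eta_1)\sqsubseteq(2^\omega,2^\omega,\mathbb{N}^\eta_0,\mathbb{N}^\eta_1)$ via a square map; i.e., the pairs $(\mathbb{N}^\eta_0,\mathbb{N}^\eta_1)$ and $(\mathbb{B}^\eta_0,\mathbb{B}^\eta_1)$ are incomparable for the square reduction.
   Context: $(X,Y,A,B)\sqsubseteq(X',Y',A',B')$ means there are injective continuous $f:X\to X'$, $g:Y\to Y'$ with $A\subseteq(f\times g)^{ -1}(A')$, $B\subseteq(f\times g)^{ -1}(B')$; "via a square map" means moreover $f=g$. Define $\varphi:\omega^{<\omega}\to\{ -1\}\cup(\eta+1)$ by $\varphi(\emptyset)=\eta$ and: $\varphi(sn)=-1$ if $\varphi(s)\leq0$; $\varphi(sn)=\theta$ if $\varphi(s)=\theta+1$; if $\varphi(s)>0$ is limit, $(\varphi(sn))_n$ is a fixed strictly increasing sequence of odd ordinals cofinal in $\varphi(s)$. $T_\eta=\{s\mid\varphi(s)\neq-1\}$. With primes $(p_q)_q$ increasing, $I(\emptyset)=0$, $I(s)=\prod_{i<|s|}p_i^{s(i)+1}$, $J:I[T_\eta]\to\omega$ the increasing bijection, $\langle s\rangle=J(I(s))$. Let $\psi:\omega\to2^{<\omega}$ list $\emptyset,\emptyset,0,0,1,1,00,00,01,01,10,10,11,11,\dots$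 (each finite binary sequence twice in a row, by length then lexicographically). Put $t^\varepsilon_\emptyset=\emptyset$, $t^\varepsilon_{sq}=t^\varepsilon_s\psi(q)0^{\langle sq\rangle-\langle s\rangle-|\psi(q)|-1}\varepsilon$ ($\varepsilon\in2$, $sq\in T_\eta$). $\mathbb{N}^\eta_\varepsilon:=\{(t^0_s\gamma,t^1_s\gamma)\mid s\in T_\eta,\ |s|\equiv\varepsilon\ (\mathrm{mod}\ 2),\ \gamma\in2^\omega\}$, $\mathbb{B}^\eta_\varepsilon:=\{(0\alpha,1\beta)\mid(\alpha,\beta)\in\mathbb{N}^\eta_\varepsilon\}$. -}

module Defs where

open import Data.Nat using (ℕ; zero; suc; _+_; _*_; _∸_; _^_; _<_; _≤ᵇ_; _≡ᵇ_)
open import Data.Nat.DivMod using (_/_; _%_)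
open import Data.Nat.Primality using (Prime)
open import Data.Bool using (Bool; true; false; not; if_then_else_)
open import Data.List using (List; []; _∷_; _++_; length; reverse; replicate; foldl; [_])
open import Data.Maybe using (Maybe; just; nothing)
open import Data.Product using (Σ; ∃; _×_; _,_)
open import Data.Unit using (⊤)
open import Data.Empty using (⊥)
open import Relation.Binary.PropositionalEquality using (_≡_; _≢_)
open import Relation.Nullary using (¬_)

-- Countable ordinals as Brouwer trees (ol f denotes sup_n f n)

data Ord : Set where
  oz : Ord
  os : Ord → Ord
  ol : (ℕ → Ord) → Ord

mutual
  _≤ₒ_ : Ord → Ord → Set
  oz ≤ₒ y = ⊤
  os x ≤ₒ y = x <ₒ y
  ol f ≤ₒ y = ∀ n → f n ≤ₒ y

  _<ₒ_ : Ord → Ord → Set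
  x <ₒ oz = ⊥
  x <ₒ os y = x ≤ₒ y
  x <ₒ ol g = ∃ λ n → x <ₒ g n

-- well-formed trees: limit nodes are given by strictly increasing
-- sequences, so that oz / os / ol really are zero / successor / limit
data WF : Ord → Set where
  wz : WF oz
  ws : ∀ {a} → WF a → WF (os a)
  wl : ∀ {f} → (∀ n → WF (f n)) → (∀ n → f n <ₒ f (suc n)) → WF (ol f)

isOdd : Ord → Bool
isOdd oz = false
isOdd (os a) = not (isOdd a)
isOdd (ol f) = false

-- cof f is "the fixed strictly increasing sequence of odd ordinals
-- cofinal in the limit ordinal ol f"; the choice depends only on the ordinal
record CofChoice (cof : (ℕ → Ord) → ℕ → Ord) : Set where
  field
    cof-wf       : ∀ f → WF (ol f) → ∀ n → WF (cof f n)
    cof-odd      : ∀ f → WF (ol f) → ∀ n → isOdd (cof f n) ≡ true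
    cof-incr     : ∀ f → WF (ol f) → ∀ n → cof f n <ₒ cof f (suc n)
    cof-below    : ∀ f → WF (ol f) → ∀ n → cof f n <ₒ ol f
    cof-cofinal  : ∀ f → WF (ol f) → ∀ α → α <ₒ ol f → ∃ λ n → α <ₒ cof f n
    cof-ext      : ∀ f g → WF (ol f) → WF (ol g) → ol f ≤ₒ ol g → ol g ≤ₒ ol f →
                   ∀ n → (cof f n ≤ₒ cof g n) × (cof g n ≤ₒ cof f n)

-- φ : ω^{<ω} → {-1} ∪ (η+1);  nothing encodes -1

φstep : ((ℕ → Ord) → ℕ → Ord) → Maybe Ord → ℕ → Maybe Ord
φstep cof nothing n = nothing
φstep cof (just oz) n = nothing
φstep cof (just (os θ)) n = just θ
φstep cof (just (ol f)) n = just (cof f n)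

φ : ((ℕ → Ord) → ℕ → Ord) → Ord → List ℕ → Maybe Ord
φ cof η s = foldl (φstep cof) (just η) s

InT : ((ℕ → Ord) → ℕ → Ord) → Ord → List ℕ → Set
InT cof η s = φ cof η s ≢ nothing

record PrimeEnum (p : ℕ → ℕ) : Set where
  field
    p-prime : ∀ q → Prime (p q)
    p-incr  : ∀ q → p q < p (suc q)
    p-all   : ∀ r → Prime r → ∃ λ q → p q ≡ r

prodFrom : (ℕ → ℕ) → ℕ → List ℕ → ℕ
prodFrom p i [] = 1
prodFrom p i (x ∷ s) = p i ^ (suc x) * prodFrom p (suc i) s

Icode : (ℕ → ℕ) → List ℕ → ℕ
Icode p [] = 0
Icode p (x ∷ s) = prodFrom p 0 (x ∷ s)

-- code = ⟨_⟩ = J ∘ I, J : I[T_η] → ω the increasing bijection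
record IsCode (p : ℕ → ℕ) (cof : (ℕ → Ord) → ℕ → Ord) (η : Ord)
              (code : List ℕ → ℕ) : Set where
  field
    code-mono : ∀ s s' → InT cof η s → InT cof η s' →
                Icode p s < Icode p s' → code s < code s'
    code-onto : ∀ k → ∃ λ s → InT cof η s × code s ≡ k

-- ψ : ω → 2^{<ω}: ∅,∅,0,0,1,1,00,00,01,01,...

bitsBelowLead : ℕ → ℕ → List Bool
bitsBelowLead zero n = []
bitsBelowLead (suc fuel) n =
  if n ≤ᵇ 1 then [] else (bitsBelowLead fuel (n / 2) ++ [ (n % 2) ≡ᵇ 1 ])

word : ℕ → List Bool
word m = bitsBelowLead (suc m) (suc m)

ψ : ℕ → List Bool
ψ q = word (q / 2)

tRev : (List ℕ → ℕ) → Bool → List ℕ → List Bool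
tRev code ε [] = []
tRev code ε (q ∷ r) =
  tRev code ε r ++ ψ q
    ++ replicate (code (reverse (q ∷ r)) ∸ code (reverse r) ∸ length (ψ q) ∸ 1) false
    ++ [ ε ]

tseq : (List ℕ → ℕ) → Bool → List ℕ → List Bool
tseq code ε s = tRev code ε (reverse s)

Cantor : Set
Cantor = ℕ → Bool

_⊕_ : List Bool → Cantor → Cantor
[] ⊕ γ = γ
(b ∷ u) ⊕ γ = λ { zero → b ; (suc n) → (u ⊕ γ) n }

_≈_ : Cantor → Cantor → Set
x ≈ y = ∀ n → x n ≡ y n

b2n : Bool → ℕ
b2n false = 0
b2n true = 1

NN : ((ℕ → Ord) → ℕ → Ord) → Ord → (List ℕ → ℕ) → Bool → Cantor → Cantor → Set
NN cof η code ε x y =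
  ∃ λ s → InT cof η s × (length s % 2 ≡ b2n ε) ×
    ∃ λ (γ : Cantor) → (x ≈ (tseq code false s ⊕ γ)) × (y ≈ (tseq code true s ⊕ γ))

BB : ((ℕ → Ord) → ℕ → Ord) → Ord → (List ℕ → ℕ) → Bool → Cantor → Cantor → Set
BB cof η code ε x y =
  ∃ λ α → ∃ λ β → NN cof η code ε α β × (x ≈ ([ false ] ⊕ α)) × (y ≈ ([ true ] ⊕ β))

Continuous : (Cantor → Cantor) → Set
Continuous f = ∀ x n → ∃ λ m → ∀ y → (∀ i → i < m → x i ≡ y i) →
                                        (∀ i → i < n → f x i ≡ f y i)

InjectiveC : (Cantor → Cantor) → Set
InjectiveC f = ∀ x y → f x ≈ f y → x ≈ y

SquareRed : (Cantor → Cantor → Set) → (Cantor → Cantor → Set) →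
            (Cantor → Cantor → Set) → (Cantor → Cantor → Set) → Set
SquareRed A B A' B' = ∃ λ (f : Cantor → Cantor) → Continuous f × InjectiveC f ×
  (∀ x y → A x y → A' (f x) (f y)) × (∀ x y → B x y → B' (f x) (f y))

-- Part one is immediate: a square map sends the diagonal pair (0^ω, 0^ω) ∈ N⁰ (take s = ∅)
-- to a diagonal pair, while the two coordinates of a point of B^η_ε differ in their first digit.
--
-- For part two let f reduce (B⁰, B¹) to (N⁰, N¹), and put b₀ = 0 0^ω and b₁ s = 1 t¹_s 0^ω.
-- If t⁰_s consists of zeros then (b₀, b₁ s) ∈ B^η_{|s| mod 2}, so f b₀ = t⁰_R δ and
-- f (b₁ s) = t¹_R δ for some R ∈ T_η. Given such s and R with φ(R) < φ(s), extend s by an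
-- entry q with ψ(q) = 0^k for k large: t⁰ stays zero, φ(sq) ≥ φ(R), and b₁ (sq) agrees with
-- b₁ s for so long that, by continuity, f (b₁ (sq)) still begins with t¹_R. Since R is read off
-- the positions where t⁰_R and t¹_R differ, the new witness R' extends R, properly because f is
-- injective; hence φ(R') < φ(R) ≤ φ(sq). Starting from s = ∅ this gives an infinite descending
-- sequence of ordinals.

module Submission where

open import Defs
open import Data.Nat using (ℕ; zero; suc; _+_; _*_; _∸_; _^_; _<_; _≤_; _≤′_; ≤′-refl; ≤′-step; z≤n; s≤s; _≤ᵇ_; _≡ᵇ_)
open import Data.Nat.Properties
open import Data.Nat.Base using (>-nonZero; nonTrivial⇒n>1)
open import Data.Nat.DivMod using (_/_; _%_; m*n/n≡m; m*n%n≡0; m/n<m; m%n<n)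
open import Data.Nat.Primality using (prime⇒nonZero; prime⇒nonTrivial)
open import Data.List using (List; []; _∷_; _++_; _∷ʳ_; length; replicate; reverse; foldl; [_])
open import Data.List.Reverse using (Reverse; []; _∶_∶ʳ_; reverseView)
open import Data.List.Properties
  using (length-++; length-replicate; foldl-++; foldl-∷ʳ; ++-assoc; ++-identityʳ; reverse-++; unfold-reverse; reverse-involutive)
open import Data.Bool using (Bool; true; false)
open import Data.Maybe using (just; nothing)
open import Data.Unit using (tt)
open import Data.Product using (∃; _×_; _,_; proj₁; proj₂)
open import Data.Empty using (⊥)
open import Relation.Binary.PropositionalEquality hiding ([_])
open import Relation.Binary.Bundles using (Setoid)
import Relation.Binary.Reasoning.Setoid as SetoidReasoning
open import Relation.Binary using (tri<; tri≈; tri>)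
open import Relation.Nullary using (¬_; contradiction)
open import Induction.WellFounded using (Acc; acc; WellFounded)
open import Data.Nat.Solver using (module +-*-Solver)

mutual
  <ₒ-≤ₒ-trans : ∀ x y w → x <ₒ y → y ≤ₒ w → x <ₒ w
  <ₒ-≤ₒ-trans x (os y) w x≤y y<w = ≤ₒ-<ₒ-trans x y w x≤y y<w
  <ₒ-≤ₒ-trans x (ol g) w (n , x<gn) g≤w = <ₒ-≤ₒ-trans x (g n) w x<gn (g≤w n)

  ≤ₒ-<ₒ-trans : ∀ x y w → x ≤ₒ y → y <ₒ w → x <ₒ w
  ≤ₒ-<ₒ-trans oz     y (os w) _ _ = tt
  ≤ₒ-<ₒ-trans (os x) y (os w) x<y y≤w = <ₒ-≤ₒ-trans x y w x<y y≤w
  ≤ₒ-<ₒ-trans (ol h) y (os w) h≤y y≤w n = ≤ₒ-trans (h n) y w (h≤y n) y≤w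
  ≤ₒ-<ₒ-trans x      y (ol g) x≤y (n , y<gn) = n , ≤ₒ-<ₒ-trans x y (g n) x≤y y<gn

  ≤ₒ-trans : ∀ x y w → x ≤ₒ y → y ≤ₒ w → x ≤ₒ w
  ≤ₒ-trans oz     y w _ _ = tt
  ≤ₒ-trans (os x) y w x<y y≤w = <ₒ-≤ₒ-trans x y w x<y y≤w
  ≤ₒ-trans (ol h) y w h≤y y≤w n = ≤ₒ-trans (h n) y w (h≤y n) y≤w

≤ₒ-limit : ∀ x g n → x ≤ₒ g n → x ≤ₒ ol g
≤ₒ-limit oz     g n _ = tt
≤ₒ-limit (os x) g n x<gn = n , x<gn
≤ₒ-limit (ol h) g n h≤gn m = ≤ₒ-limit (h m) g n (h≤gn m)

mutual
  <ₒ⇒≤ₒ : ∀ x y → x <ₒ y → x ≤ₒ y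
  <ₒ⇒≤ₒ x (os y) x≤y = ≤ₒ-step x y x≤y
  <ₒ⇒≤ₒ x (ol g) (n , x<gn) = ≤ₒ-limit x g n (<ₒ⇒≤ₒ x (g n) x<gn)

  ≤ₒ-step : ∀ x y → x ≤ₒ y → x ≤ₒ os y
  ≤ₒ-step oz     y _ = tt
  ≤ₒ-step (os x) y x<y = <ₒ⇒≤ₒ x y x<y
  ≤ₒ-step (ol h) y h≤y n = ≤ₒ-step (h n) y (h≤y n)

≤ₒ-refl : ∀ x → x ≤ₒ x
≤ₒ-refl oz       = tt
≤ₒ-refl (os x)   = ≤ₒ-refl x
≤ₒ-refl (ol h) n = ≤ₒ-limit (h n) h n (≤ₒ-refl (h n))

<ₒ-wellFounded : WellFounded _<ₒ_
<ₒ-wellFounded x = acc (acc-below x _)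
  where
  acc-below : ∀ y x → x <ₒ y → Acc _<ₒ_ x
  acc-below (os y) x x≤y = acc λ {w} w<x → acc-below y w (<ₒ-≤ₒ-trans w x y w<x x≤y)
  acc-below (ol g) x (n , x<gn) = acc-below (g n) x x<gn

replicate-+ : ∀ m n {b : Bool} → replicate (m + n) b ≡ replicate m b ++ replicate n b
replicate-+ zero    n = refl
replicate-+ (suc m) n = cong (_ ∷_) (replicate-+ m n)

replicate-∷ʳ : ∀ k → replicate k false ++ [ false ] ≡ replicate (suc k) false
replicate-∷ʳ zero    = refl
replicate-∷ʳ (suc k) = cong (false ∷_) (replicate-∷ʳ k)

zeros : Cantor
zeros _ = false

Cantor-setoid : Setoid _ _
Cantor-setoid = ℕ →-setoid Bool

open Setoid Cantor-setoid using () renaming (sym to ≈-sym; trans to ≈-trans)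

Agree : ℕ → Cantor → Cantor → Set
Agree n x y = ∀ i → i < n → x i ≡ y i

Agree-≤ : ∀ {m n x y} → m ≤ n → Agree n x y → Agree m x y
Agree-≤ m≤n agree i i<m = agree i (<-≤-trans i<m m≤n)

_◁_ : List Bool → Cantor → Set
u ◁ x = ∃ λ γ → x ≈ (u ⊕ γ)

⊕-++ : ∀ u v γ → ((u ++ v) ⊕ γ) ≈ (u ⊕ (v ⊕ γ))
⊕-++ []      v γ n       = refl
⊕-++ (b ∷ u) v γ zero    = refl
⊕-++ (b ∷ u) v γ (suc n) = ⊕-++ u v γ n

⊕-drop : ∀ u γ j → (u ⊕ γ) (length u + j) ≡ γ j
⊕-drop []      γ j = refl
⊕-drop (b ∷ u) γ j = ⊕-drop u γ j

⊕-at-length : ∀ w {δ} → (w ⊕ δ) (length w) ≡ δ 0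
⊕-at-length []      = refl
⊕-at-length (c ∷ w) = ⊕-at-length w

⊕-cong : ∀ u {γ γ'} → γ ≈ γ' → (u ⊕ γ) ≈ (u ⊕ γ')
⊕-cong []      γ≈γ' n       = γ≈γ' n
⊕-cong (b ∷ u) γ≈γ' zero    = refl
⊕-cong (b ∷ u) γ≈γ' (suc n) = ⊕-cong u γ≈γ' n

⊕-agree : ∀ u γ γ' → Agree (length u) (u ⊕ γ) (u ⊕ γ')
⊕-agree (b ∷ u) γ γ' zero    _         = refl
⊕-agree (b ∷ u) γ γ' (suc i) (s≤s i<u) = ⊕-agree u γ γ' i i<u

⊕-cancel : ∀ u {x γ γ'} → x ≈ (u ⊕ γ) → x ≈ (u ⊕ γ') → γ ≈ γ'
⊕-cancel u {γ = γ} {γ'} x≈uγ x≈uγ' j =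
  trans (sym (⊕-drop u γ j)) (trans (sym (x≈uγ _)) (trans (x≈uγ' _) (⊕-drop u γ' j)))

replicate-⊕-zeros : ∀ n → (replicate n false ⊕ zeros) ≈ zeros
replicate-⊕-zeros zero    i       = refl
replicate-⊕-zeros (suc n) zero    = refl
replicate-⊕-zeros (suc n) (suc i) = replicate-⊕-zeros n i

++-replicate-⊕-zeros : ∀ u n → ((u ++ replicate n false) ⊕ zeros) ≈ (u ⊕ zeros)
++-replicate-⊕-zeros u n = ≈-trans (⊕-++ u _ zeros) (⊕-cong u (replicate-⊕-zeros n))

◁-++⁻ : ∀ u v {x} → (u ++ v) ◁ x → u ◁ x
◁-++⁻ u v (γ , x≈) = v ⊕ γ , ≈-trans x≈ (⊕-++ u v γ)

record Diverge (L n : ℕ) (x y : Cantor) : Set where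
  constructor diverge
  field
    agree  : ∀ j → j < n → x (L + j) ≡ y (L + j)
    differ : x (L + n) ≢ y (L + n)

Diverge-unique : ∀ {L m n x y} → Diverge L m x y → Diverge L n x y → m ≡ n
Diverge-unique {m = m} {n} (diverge agreeₘ differₘ) (diverge agreeₙ differₙ) with <-cmp m n
... | tri< m<n _ _ = contradiction (agreeₙ m m<n) differₘ
... | tri≈ _ m≡n _ = m≡n
... | tri> _ _ n<m = contradiction (agreeₘ n n<m) differₙ

Diverge-transfer : ∀ {L n x y y'} → Agree (L + suc n) y y' → Diverge L n x y → Diverge L n x y'
Diverge-transfer {L} y≈y' (diverge agree differ) = diverge
    (λ j j<n → trans (agree j j<n) (y≈y' (L + j) (+-monoʳ-< L (m<n⇒m<1+n j<n))))
    (λ x≡y' → differ (trans x≡y' (sym (y≈y' _ (+-monoʳ-< L ≤-refl)))))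

¬Diverge-sharedTail : ∀ u u' {n x y δ} → length u ≡ length u' →
                      x ≈ (u ⊕ δ) → y ≈ (u' ⊕ δ) → ¬ Diverge (length u) n x y
¬Diverge-sharedTail u u' {n} {δ = δ} |u|≡|u'| x≈ y≈ (diverge _ differ) = differ (begin
  _                      ≡⟨ x≈ _ ⟩
  (u ⊕ δ) (length u + n)   ≡⟨ ⊕-drop u δ n ⟩
  δ n                      ≡⟨ ⊕-drop u' δ n ⟨
  (u' ⊕ δ) (length u' + n) ≡⟨ cong (λ L → (u' ⊕ δ) (L + n)) |u|≡|u'| ⟨
  (u' ⊕ δ) (length u + n)  ≡⟨ y≈ _ ⟨
  _                        ∎)
  where open ≡-Reasoning

Diverge-at : ∀ u u' w {x y} → length u ≡ length u' →
             (u ++ (w ++ [ false ])) ◁ x → (u' ++ (w ++ [ true ])) ◁ y →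
             Diverge (length u) (length w) x y
Diverge-at u u' w {x} {y} |u|≡|u'| (γ , x≈) (γ' , y≈) = diverge
    (λ j j<w → trans (x-after j) (trans (⊕-agree w _ _ j j<w) (sym (y-after j))))
    λ x≡y → false≢true (trans (sym (⊕-at-length w)) (trans (sym (x-after _))
              (trans x≡y (trans (y-after _) (⊕-at-length w)))))
  where
  false≢true : false ≢ true
  false≢true ()
  x-after : ∀ j → x (length u + j) ≡ (w ⊕ ([ false ] ⊕ γ)) j
  x-after j = trans (x≈ _) (trans (⊕-++ u _ γ _) (trans (⊕-drop u _ j) (⊕-++ w _ γ j)))
  y-after : ∀ j → y (length u + j) ≡ (w ⊕ ([ true ] ⊕ γ')) j
  y-after j = trans (cong (λ L → y (L + j)) |u|≡|u'|)
    (trans (y≈ _) (trans (⊕-++ u' _ γ' _) (trans (⊕-drop u' _ j) (⊕-++ w _ γ' j))))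

parity : ∀ n → ∃ λ ε → n % 2 ≡ b2n ε
parity n with n % 2 | m%n<n n 2
... | zero        | _ = false , refl
... | suc zero    | _ = true , refl
... | suc (suc _) | s≤s (s≤s ())

length-bitsBelowLead : ∀ fuel n → length (bitsBelowLead fuel n) ≤ fuel
length-bitsBelowLead zero       n = z≤n
length-bitsBelowLead (suc fuel) n with n ≤ᵇ 1
... | true  = z≤n
... | false = begin
  length (bitsBelowLead fuel (n / 2) ++ [ n % 2 ≡ᵇ 1 ]) ≡⟨ length-++ (bitsBelowLead fuel (n / 2)) ⟩
  length (bitsBelowLead fuel (n / 2)) + 1              ≤⟨ +-monoˡ-≤ 1 (length-bitsBelowLead fuel (n / 2)) ⟩
  fuel + 1                                             ≡⟨ +-comm fuel 1 ⟩
  suc fuel                                             ∎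
  where open ≤-Reasoning

length-ψ≤ : ∀ q → length (ψ q) ≤ q
length-ψ≤ zero          = z≤n
length-ψ≤ (suc zero)    = z≤n
length-ψ≤ (suc (suc k)) =
  ≤-trans (length-bitsBelowLead (suc m) (suc m)) (m/n<m (2 + k) 2 (s≤s (s≤s z≤n)))
  where m = (2 + k) / 2

bitsBelowLead-*2 : ∀ fuel m → 1 ≤ m →
                   bitsBelowLead (suc fuel) (m * 2) ≡ bitsBelowLead fuel m ++ [ false ]
bitsBelowLead-*2 fuel (suc m) _ =
  cong₂ (λ a b → bitsBelowLead fuel a ++ [ b ≡ᵇ 1 ]) (m*n/n≡m (suc m) 2) (m*n%n≡0 (suc m) 2)

bitsBelowLead-2^ : ∀ fuel k → k < fuel → bitsBelowLead fuel (2 ^ k) ≡ replicate k false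
bitsBelowLead-2^ (suc fuel) zero    _ = refl
bitsBelowLead-2^ (suc fuel) (suc k) (s≤s k<fuel) = begin
  bitsBelowLead (suc fuel) (2 * 2 ^ k)        ≡⟨ cong (bitsBelowLead (suc fuel)) (*-comm 2 (2 ^ k)) ⟩
  bitsBelowLead (suc fuel) (2 ^ k * 2)        ≡⟨ bitsBelowLead-*2 fuel (2 ^ k) (m^n>0 2 k) ⟩
  bitsBelowLead fuel (2 ^ k) ++ [ false ]     ≡⟨ cong (_++ [ false ]) (bitsBelowLead-2^ fuel k k<fuel) ⟩
  replicate k false ++ [ false ]              ≡⟨ replicate-∷ʳ k ⟩
  replicate (suc k) false                     ∎
  where open ≡-Reasoning

n<2^n : ∀ n → n < 2 ^ n
n<2^n zero    = s≤s z≤n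
n<2^n (suc n) = +-mono-≤ (m^n>0 2 n) (≤-trans (n<2^n n) (m≤m+n (2 ^ n) 0))

-- ψ (2 (2^k − 1)) = word (2^k − 1) is the binary expansion of 2^k below its leading 1.
ψ-replicate : ∀ k → ∃ λ q → k ≤ q × ψ q ≡ replicate k false
ψ-replicate k = m * 2 , ≤-trans (∸-monoˡ-≤ 1 (n<2^n k)) (m≤m*n m 2) , (begin
  word (m * 2 / 2)               ≡⟨ cong word (m*n/n≡m m 2) ⟩
  bitsBelowLead (suc m) (suc m)  ≡⟨ cong (λ n → bitsBelowLead n n) (trans (+-comm 1 m) (m∸n+n≡m (m^n>0 2 k))) ⟩
  bitsBelowLead (2 ^ k) (2 ^ k)  ≡⟨ bitsBelowLead-2^ (2 ^ k) k (n<2^n k) ⟩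
  replicate k false              ∎)
  where
  m = 2 ^ k ∸ 1
  open ≡-Reasoning

module _ {p : ℕ → ℕ} (pe : PrimeEnum p) where
  open PrimeEnum pe

  p>1 : ∀ i → 1 < p i
  p>1 i = nonTrivial⇒n>1 (p i) {{prime⇒nonTrivial (p-prime i)}}

  prodFrom-pos : ∀ i s → 0 < prodFrom p i s
  prodFrom-pos i []      = s≤s z≤n
  prodFrom-pos i (x ∷ s) = *-mono-≤ (m^n>0 (p i) {{prime⇒nonZero (p-prime i)}} (suc x)) (prodFrom-pos (suc i) s)

  prodFrom-∷ʳ : ∀ i s q → prodFrom p i (s ∷ʳ q) ≡ prodFrom p i s * p (i + length s) ^ suc q
  prodFrom-∷ʳ i [] q = begin
    p i ^ suc q * 1          ≡⟨ *-identityʳ _ ⟩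
    p i ^ suc q              ≡⟨ cong (λ j → p j ^ suc q) (+-identityʳ i) ⟨
    p (i + 0) ^ suc q        ≡⟨ *-identityˡ _ ⟨
    1 * p (i + 0) ^ suc q    ∎
    where open ≡-Reasoning
  prodFrom-∷ʳ i (x ∷ s) q = begin
    p i ^ suc x * prodFrom p (suc i) (s ∷ʳ q)
      ≡⟨ cong (p i ^ suc x *_) (prodFrom-∷ʳ (suc i) s q) ⟩
    p i ^ suc x * (prodFrom p (suc i) s * p (suc i + length s) ^ suc q)
      ≡⟨ *-assoc (p i ^ suc x) _ _ ⟨
    p i ^ suc x * prodFrom p (suc i) s * p (suc i + length s) ^ suc q
      ≡⟨ cong (λ j → p i ^ suc x * prodFrom p (suc i) s * p j ^ suc q) (+-suc i (length s)) ⟨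
    p i ^ suc x * prodFrom p (suc i) s * p (i + suc (length s)) ^ suc q
      ∎
    where open ≡-Reasoning

  Icode-∷ʳ : ∀ s q → Icode p (s ∷ʳ q) ≡ prodFrom p 0 s * p (length s) ^ suc q
  Icode-∷ʳ []      q = prodFrom-∷ʳ 0 [] q
  Icode-∷ʳ (x ∷ s) q = prodFrom-∷ʳ 0 (x ∷ s) q

  Icode-<-∷ʳ : ∀ s q → Icode p s < Icode p (s ∷ʳ q)
  Icode-<-∷ʳ []      q = prodFrom-pos 0 [ q ]
  Icode-<-∷ʳ (x ∷ s) q = subst (prodFrom p 0 (x ∷ s) <_) (sym (Icode-∷ʳ (x ∷ s) q))
    (m<m*n _ _ {{>-nonZero (prodFrom-pos 0 (x ∷ s))}} (^-monoʳ-< (p (suc (length s))) (p>1 _) {0} {suc q} (s≤s z≤n)))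

  Icode-∷ʳ-< : ∀ s {q q'} → q < q' → Icode p (s ∷ʳ q) < Icode p (s ∷ʳ q')
  Icode-∷ʳ-< s {q} {q'} q<q' rewrite Icode-∷ʳ s q | Icode-∷ʳ s q' =
    *-monoʳ-< (prodFrom p 0 s) {{>-nonZero (prodFrom-pos 0 s)}} (^-monoʳ-< (p (length s)) (p>1 (length s)) (s≤s q<q'))

module _ {cof : (ℕ → Ord) → ℕ → Ord} (cc : CofChoice cof) where
  open CofChoice cc

  cof-mono : ∀ g → WF (ol g) → ∀ {m n} → m ≤′ n → cof g m ≤ₒ cof g n
  cof-mono g w {m} ≤′-refl = ≤ₒ-refl (cof g m)
  cof-mono g w {m} (≤′-step {n} m≤′n) =
    ≤ₒ-trans (cof g m) (cof g n) (cof g (suc n)) (cof-mono g w m≤′n) (<ₒ⇒≤ₒ (cof g n) (cof g (suc n)) (cof-incr g w n))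

  φstep-< : ∀ b q {a} → WF b → φstep cof (just b) q ≡ just a → WF a × a <ₒ b
  φstep-< (os b) q (ws w) refl = w , ≤ₒ-refl b
  φstep-< (ol f) q w      refl = cof-wf f w q , cof-below f w q

  φstep-eventually-≥ : ∀ a b → WF a → b <ₒ a →
    ∃ λ n → ∀ q → n ≤ q → ∃ λ a' → φstep cof (just a) q ≡ just a' × b ≤ₒ a'
  φstep-eventually-≥ (os a) b _ b≤a = 0 , λ q _ → a , refl , b≤a
  φstep-eventually-≥ (ol g) b w b<g with cof-cofinal g w b b<g
  ... | n , b<gn = n , λ q n≤q → cof g q , refl ,
    <ₒ⇒≤ₒ b (cof g q) (<ₒ-≤ₒ-trans b (cof g n) (cof g q) b<gn (cof-mono g w (≤⇒≤′ n≤q)))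

  foldl-φstep-nothing : ∀ M → foldl (φstep cof) nothing M ≡ nothing
  foldl-φstep-nothing []      = refl
  foldl-φstep-nothing (q ∷ M) = foldl-φstep-nothing M

  foldl-φstep-just : ∀ M m {a} → foldl (φstep cof) m M ≡ just a → ∃ λ b → m ≡ just b
  foldl-φstep-just M nothing  e = contradiction (trans (sym e) (foldl-φstep-nothing M)) λ ()
  foldl-φstep-just M (just b) e = b , refl

  mutual
    foldl-φstep-≤ : ∀ M b {a} → WF b → foldl (φstep cof) (just b) M ≡ just a → WF a × a ≤ₒ b
    foldl-φstep-≤ []      b w refl = w , ≤ₒ-refl b
    foldl-φstep-≤ (q ∷ M) b w e with foldl-φstep-< q M b w e
    ... | wa , a<b = wa , <ₒ⇒≤ₒ _ b a<b

    foldl-φstep-< : ∀ q M b {a} → WF b → foldl (φstep cof) (just b) (q ∷ M) ≡ just a → WF a × a <ₒ b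
    foldl-φstep-< q M b {a} w e =
      let c , step = foldl-φstep-just M (φstep cof (just b) q) e
          wc , c<b = φstep-< b q w step
          wa , a≤c = foldl-φstep-≤ M c wc (subst (λ m → foldl (φstep cof) m M ≡ just a) step e)
      in wa , ≤ₒ-<ₒ-trans a c b a≤c c<b

  module _ {η : Ord} (wη : WF η) where

    φ-∷ʳ : ∀ s q → φ cof η (s ∷ʳ q) ≡ φstep cof (φ cof η s) q
    φ-∷ʳ s q = foldl-∷ʳ (φstep cof) (just η) q s

    φ-++ : ∀ s M → φ cof η (s ++ M) ≡ foldl (φstep cof) (φ cof η s) M
    φ-++ s M = foldl-++ (φstep cof) (just η) s M

    φ-wf : ∀ s {a} → φ cof η s ≡ just a → WF a
    φ-wf s e = proj₁ (foldl-φstep-≤ s η wη e)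

    φ-++-< : ∀ s q M {a b} → φ cof η s ≡ just b → φ cof η (s ++ q ∷ M) ≡ just a → a <ₒ b
    φ-++-< s q M {b = b} φs≡b e = proj₂ (foldl-φstep-< q M b (φ-wf s φs≡b) (begin
      foldl (φstep cof) (just b) (q ∷ M)       ≡⟨ cong (λ m → foldl (φstep cof) m (q ∷ M)) φs≡b ⟨
      foldl (φstep cof) (φ cof η s) (q ∷ M)    ≡⟨ φ-++ s (q ∷ M) ⟨
      φ cof η (s ++ q ∷ M)                     ≡⟨ e ⟩
      _                                        ∎))
      where open ≡-Reasoning

    InT-label : ∀ s → InT cof η s → ∃ λ a → φ cof η s ≡ just a
    InT-label s inT with φ cof η s
    ... | nothing = contradiction refl inT
    ... | just a  = a , refl

    label⇒InT : ∀ s {a} → φ cof η s ≡ just a → InT cof η s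
    label⇒InT s φs≡a φs≡nothing with trans (sym φs≡a) φs≡nothing
    ... | ()

    InT-++⁻ : ∀ s M → InT cof η (s ++ M) → InT cof η s
    InT-++⁻ s M inT φs≡nothing = inT (begin
      φ cof η (s ++ M)                       ≡⟨ φ-++ s M ⟩
      foldl (φstep cof) (φ cof η s) M        ≡⟨ cong (λ m → foldl (φstep cof) m M) φs≡nothing ⟩
      foldl (φstep cof) nothing M            ≡⟨ foldl-φstep-nothing M ⟩
      nothing                                ∎)
      where open ≡-Reasoning

    InT-sibling : ∀ s q q' → InT cof η (s ∷ʳ q) → InT cof η (s ∷ʳ q')
    InT-sibling s q q' inT rewrite φ-∷ʳ s q | φ-∷ʳ s q' with φ cof η s
    ... | nothing     = contradiction refl inT
    ... | just oz     = contradiction refl inT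
    ... | just (os a) = λ ()
    ... | just (ol f) = λ ()

    module _ {p : ℕ → ℕ} (pe : PrimeEnum p) {code : List ℕ → ℕ} (ic : IsCode p cof η code) where
      open IsCode ic

      code-<-∷ʳ : ∀ s q → InT cof η (s ∷ʳ q) → code s < code (s ∷ʳ q)
      code-<-∷ʳ s q inT = code-mono s (s ∷ʳ q) (InT-++⁻ s [ q ] inT) inT (Icode-<-∷ʳ pe s q)

      code-∷ʳ-< : ∀ s {q q'} → InT cof η (s ∷ʳ q) → InT cof η (s ∷ʳ q') → q < q' →
                  code (s ∷ʳ q) < code (s ∷ʳ q')
      code-∷ʳ-< s inT inT' q<q' = code-mono _ _ inT inT' (Icode-∷ʳ-< pe s q<q')

      code-∷ʳ-≥ : ∀ s q → InT cof η (s ∷ʳ q) → code s + suc q ≤ code (s ∷ʳ q)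
      code-∷ʳ-≥ s zero    inT = subst (_≤ code (s ∷ʳ 0)) (+-comm 1 (code s)) (code-<-∷ʳ s 0 inT)
      code-∷ʳ-≥ s (suc q) inT = begin
        code s + suc (suc q)   ≡⟨ +-suc (code s) (suc q) ⟩
        suc (code s + suc q)   ≤⟨ s≤s (code-∷ʳ-≥ s q inT') ⟩
        suc (code (s ∷ʳ q))    ≤⟨ code-∷ʳ-< s inT' inT (n<1+n q) ⟩
        code (s ∷ʳ suc q)      ∎
        where
        open ≤-Reasoning
        inT' = InT-sibling s (suc q) q inT

      code-∷ʳ-injective : ∀ s {q q'} → InT cof η (s ∷ʳ q) → InT cof η (s ∷ʳ q') →
                          code (s ∷ʳ q) ≡ code (s ∷ʳ q') → q ≡ q'
      code-∷ʳ-injective s {q} {q'} inT inT' e with <-cmp q q'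
      ... | tri< q<q' _ _ = contradiction e (<⇒≢ (code-∷ʳ-< s inT inT' q<q'))
      ... | tri≈ _ q≡q' _ = q≡q'
      ... | tri> _ _ q'<q = contradiction (sym e) (<⇒≢ (code-∷ʳ-< s inT' inT q'<q))

      t : Bool → List ℕ → List Bool
      t = tseq code

      gap : List ℕ → ℕ → List Bool
      gap s q = ψ q ++ replicate (code (s ∷ʳ q) ∸ code s ∸ length (ψ q) ∸ 1) false

      t-∷ʳ : ∀ ε s q → t ε (s ∷ʳ q) ≡ t ε s ++ (gap s q ++ [ ε ])
      t-∷ʳ ε s q = begin
        tRev code ε (reverse (s ∷ʳ q))
          ≡⟨ cong (tRev code ε) (reverse-++ s [ q ]) ⟩
        tRev code ε (reverse s) ++ ψ q ++ replicate (code (reverse (q ∷ reverse s)) ∸ code (reverse (reverse s)) ∸ length (ψ q) ∸ 1) false ++ [ ε ]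
          ≡⟨ cong₂ (λ c c' → t ε s ++ ψ q ++ replicate (c ∸ c' ∸ length (ψ q) ∸ 1) false ++ [ ε ])
                   (cong code (trans (unfold-reverse q (reverse s)) (cong (_∷ʳ q) (reverse-involutive s))))
                   (cong code (reverse-involutive s)) ⟩
        t ε s ++ ψ q ++ replicate (code (s ∷ʳ q) ∸ code s ∸ length (ψ q) ∸ 1) false ++ [ ε ]
          ≡⟨ cong (t ε s ++_) (++-assoc (ψ q) _ [ ε ]) ⟨
        t ε s ++ (gap s q ++ [ ε ])
          ∎
        where open ≡-Reasoning

      length-t-∷ʳ : ∀ ε s q → length (t ε (s ∷ʳ q)) ≡ length (t ε s) + suc (length (gap s q))
      length-t-∷ʳ ε s q = begin
        length (t ε (s ∷ʳ q))                          ≡⟨ cong length (t-∷ʳ ε s q) ⟩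
        length (t ε s ++ (gap s q ++ [ ε ]))           ≡⟨ length-++ (t ε s) ⟩
        length (t ε s) + length (gap s q ++ [ ε ])     ≡⟨ cong (length (t ε s) +_) (length-++ (gap s q)) ⟩
        length (t ε s) + (length (gap s q) + 1)        ≡⟨ cong (length (t ε s) +_) (+-comm _ 1) ⟩
        length (t ε s) + suc (length (gap s q))        ∎
        where open ≡-Reasoning

      length-t : ∀ s → length (t false s) ≡ length (t true s)
      length-t s = go (reverseView s)
        where
        go : ∀ {s} → Reverse s → length (t false s) ≡ length (t true s)
        go []              = refl
        go (s ∶ view ∶ʳ q) = begin
          length (t false (s ∷ʳ q))                 ≡⟨ length-t-∷ʳ false s q ⟩
          length (t false s) + suc (length (gap s q)) ≡⟨ cong (_+ suc (length (gap s q))) (go view) ⟩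
          length (t true s) + suc (length (gap s q))  ≡⟨ length-t-∷ʳ true s q ⟨
          length (t true (s ∷ʳ q))                  ∎
          where open ≡-Reasoning

      t-++ : ∀ ε s M → ∃ λ w → t ε (s ++ M) ≡ t ε s ++ w
      t-++ ε s M = go (reverseView M)
        where
        go : ∀ {M} → Reverse M → ∃ λ w → t ε (s ++ M) ≡ t ε s ++ w
        go [] = [] , trans (cong (t ε) (++-identityʳ s)) (sym (++-identityʳ (t ε s)))
        go (M ∶ view ∶ʳ q) with go view
        ... | w , e = w ++ (gap (s ++ M) q ++ [ ε ]) , (begin
          t ε (s ++ (M ∷ʳ q))                         ≡⟨ cong (t ε) (++-assoc s M [ q ]) ⟨
          t ε ((s ++ M) ∷ʳ q)                         ≡⟨ t-∷ʳ ε (s ++ M) q ⟩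
          t ε (s ++ M) ++ (gap (s ++ M) q ++ [ ε ])   ≡⟨ cong (_++ _) e ⟩
          (t ε s ++ w) ++ (gap (s ++ M) q ++ [ ε ])   ≡⟨ ++-assoc (t ε s) w _ ⟩
          t ε s ++ (w ++ (gap (s ++ M) q ++ [ ε ]))   ∎)
          where open ≡-Reasoning

      -- code s + |ψ q| + 1 ≤ code (s q), so the truncated subtractions in gap are exact.
      length-gap : ∀ s q → InT cof η (s ∷ʳ q) → length (gap s q) + suc (code s) ≡ code (s ∷ʳ q)
      length-gap s q inT = begin
        length (gap s q) + suc d                 ≡⟨ cong (_+ suc d) (length-++ (ψ q)) ⟩
        k + length (replicate (c ∸ d ∸ k ∸ 1) false) + suc d
                                                 ≡⟨ cong (λ n → k + n + suc d) (length-replicate (c ∸ d ∸ k ∸ 1)) ⟩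
        k + (c ∸ d ∸ k ∸ 1) + suc d              ≡⟨ cong (λ n → k + n + suc d) (trans (∸-+-assoc (c ∸ d) k 1) (∸-+-assoc c d (k + 1))) ⟩
        k + (c ∸ (d + (k + 1))) + suc d          ≡⟨ rearrange k (c ∸ (d + (k + 1))) d ⟩
        c ∸ (d + (k + 1)) + (d + (k + 1))        ≡⟨ m∸n+n≡m d+k+1≤c ⟩
        c                                        ∎
        where
        open ≡-Reasoning
        c = code (s ∷ʳ q)
        d = code s
        k = length (ψ q)
        d+k+1≤c : d + (k + 1) ≤ c
        d+k+1≤c = ≤-trans (+-monoʳ-≤ d (subst (_≤ suc q) (+-comm 1 k) (s≤s (length-ψ≤ q)))) (code-∷ʳ-≥ s q inT)
        rearrange : ∀ k x d → k + x + suc d ≡ x + (d + (k + 1))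
        rearrange = solve 3 (λ k x d → k :+ x :+ (con 1 :+ d) := x :+ (d :+ (k :+ con 1))) refl
          where open +-*-Solver

      length-gap-injective : ∀ s {q q'} → InT cof η (s ∷ʳ q) → InT cof η (s ∷ʳ q') →
                             length (gap s q) ≡ length (gap s q') → q ≡ q'
      length-gap-injective s {q} {q'} inT inT' e = code-∷ʳ-injective s inT inT' (begin
        code (s ∷ʳ q)                       ≡⟨ length-gap s q inT ⟨
        length (gap s q) + suc (code s)     ≡⟨ cong (_+ suc (code s)) e ⟩
        length (gap s q') + suc (code s)    ≡⟨ length-gap s q' inT' ⟩
        code (s ∷ʳ q')                      ∎)
        where open ≡-Reasoning

      t-Diverge : ∀ s q {x y} → t false (s ∷ʳ q) ◁ x → t true (s ∷ʳ q) ◁ y →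
                  Diverge (length (t false s)) (length (gap s q)) x y
      t-Diverge s q {x} {y} x◁ y◁ = Diverge-at (t false s) (t true s) (gap s q) (length-t s)
        (subst (_◁ x) (t-∷ʳ false s q) x◁) (subst (_◁ y) (t-∷ʳ true s q) y◁)

      t-◁-++⁻ : ∀ ε s M {x} → t ε (s ++ M) ◁ x → t ε s ◁ x
      t-◁-++⁻ ε s M {x} x◁ with t-++ ε s M
      ... | w , e = ◁-++⁻ (t ε s) w (subst (_◁ x) e x◁)

      -- After t_P, the pairs (x, y) and (x, y') first differ once the gap of their next entry
      -- is passed, and the length of that gap determines the entry.
      t-prefix : ∀ R {R' x y y' δ} → InT cof η R → InT cof η R' →
                 t false R ◁ x → t true R ◁ y → x ≈ (t false R' ⊕ δ) → y' ≈ (t true R' ⊕ δ) →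
                 Agree (length (t true R)) y y' → ∃ λ M → R' ≡ R ++ M
      t-prefix R = go (reverseView R)
        where
        go : ∀ {R} → Reverse R → ∀ {R' x y y' δ} → InT cof η R → InT cof η R' →
             t false R ◁ x → t true R ◁ y → x ≈ (t false R' ⊕ δ) → y' ≈ (t true R' ⊕ δ) →
             Agree (length (t true R)) y y' → ∃ λ M → R' ≡ R ++ M
        go [] {R'} _ _ _ _ _ _ _ = R' , refl
        go (P ∶ view ∶ʳ q) {R'} {x} {y} {y'} {δ} inT inT' x◁ y◁ x≈ y'≈ y≈y' = extend (go view
             (InT-++⁻ P [ q ] inT) inT' (t-◁-++⁻ false P [ q ] x◁) (t-◁-++⁻ true P [ q ] y◁) x≈ y'≈
             (Agree-≤ (subst (length (t true P) ≤_) (sym (length-t-∷ʳ true P q)) (m≤m+n _ _)) y≈y'))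
          where
          |t-P∷ʳq| : length (t true (P ∷ʳ q)) ≡ length (t false P) + suc (length (gap P q))
          |t-P∷ʳq| = trans (length-t-∷ʳ true P q) (cong (_+ suc (length (gap P q))) (sym (length-t P)))
          x-y'-diverge : Diverge (length (t false P)) (length (gap P q)) x y'
          x-y'-diverge = Diverge-transfer (subst (λ n → Agree n y y') |t-P∷ʳq| y≈y') (t-Diverge P q x◁ y◁)
          extend : ∃ (λ N → R' ≡ P ++ N) → ∃ λ M → R' ≡ (P ∷ʳ q) ++ M
          extend ([] , R'≡P) = contradiction x-y'-diverge (¬Diverge-sharedTail (t false P) (t true P) (length-t P)
            (subst (λ s → x ≈ (t false s ⊕ δ)) (trans R'≡P (++-identityʳ P)) x≈)
            (subst (λ s → y' ≈ (t true s ⊕ δ)) (trans R'≡P (++-identityʳ P)) y'≈))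
          extend (q' ∷ M , R'≡) = M , trans R'≡P∷ʳq'++M (cong (λ c → P ∷ʳ c ++ M) (sym q≡q'))
            where
            R'≡P∷ʳq'++M : R' ≡ (P ∷ʳ q') ++ M
            R'≡P∷ʳq'++M = trans R'≡ (sym (++-assoc P [ q' ] M))
            x-y'-diverge' : Diverge (length (t false P)) (length (gap P q')) x y'
            x-y'-diverge' = t-Diverge P q'
              (t-◁-++⁻ false (P ∷ʳ q') M (δ , subst (λ s → x ≈ (t false s ⊕ δ)) R'≡P∷ʳq'++M x≈))
              (t-◁-++⁻ true (P ∷ʳ q') M (δ , subst (λ s → y' ≈ (t true s ⊕ δ)) R'≡P∷ʳq'++M y'≈))
            q≡q' : q ≡ q'
            q≡q' = length-gap-injective P inT (InT-++⁻ (P ∷ʳ q') M (subst (InT cof η) R'≡P∷ʳq'++M inT'))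
                     (Diverge-unique x-y'-diverge x-y'-diverge')

      gap-replicate : ∀ s q k → ψ q ≡ replicate k false → ∃ λ n → k ≤ n × gap s q ≡ replicate n false
      gap-replicate s q k ψq≡ = k + r , m≤m+n k r ,
        trans (cong (_++ replicate r false) ψq≡) (sym (replicate-+ k r))
        where r = code (s ∷ʳ q) ∸ code s ∸ length (ψ q) ∸ 1

      AllZero : List ℕ → Set
      AllZero s = zeros ≈ (t false s ⊕ zeros)

      ++-gap-⊕-zeros : ∀ u s q {n} → gap s q ≡ replicate n false →
                       ((u ++ (gap s q ++ [ false ])) ⊕ zeros) ≈ (u ⊕ zeros)
      ++-gap-⊕-zeros u s q {n} gap≡ = begin
        (u ++ (gap s q ++ [ false ])) ⊕ zeros            ≡⟨ cong (λ w → (u ++ (w ++ [ false ])) ⊕ zeros) gap≡ ⟩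
        (u ++ (replicate n false ++ [ false ])) ⊕ zeros  ≡⟨ cong (λ w → (u ++ w) ⊕ zeros) (replicate-∷ʳ n) ⟩
        (u ++ replicate (suc n) false) ⊕ zeros           ≈⟨ ++-replicate-⊕-zeros u (suc n) ⟩
        u ⊕ zeros                                        ∎
        where open SetoidReasoning Cantor-setoid

      AllZero-∷ʳ : ∀ s q {n} → gap s q ≡ replicate n false → AllZero s → AllZero (s ∷ʳ q)
      AllZero-∷ʳ s q gap≡ zeros≈ = begin
        zeros                                           ≈⟨ zeros≈ ⟩
        t false s ⊕ zeros                               ≈⟨ ++-gap-⊕-zeros (t false s) s q gap≡ ⟨
        (t false s ++ (gap s q ++ [ false ])) ⊕ zeros   ≡⟨ cong (_⊕ zeros) (t-∷ʳ false s q) ⟨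
        t false (s ∷ʳ q) ⊕ zeros                        ∎
        where open SetoidReasoning Cantor-setoid

      b₀ : Cantor
      b₀ = [ false ] ⊕ zeros

      b₁ : List ℕ → Cantor
      b₁ s = [ true ] ⊕ (t true s ⊕ zeros)

      b₁-Diverge : ∀ s q {n} → gap s q ≡ replicate n false →
                   Diverge 0 (length (true ∷ t true s ++ gap s q)) (b₁ s) (b₁ (s ∷ʳ q))
      b₁-Diverge s q gap≡ = Diverge-at [] [] (true ∷ t true s ++ gap s q) refl
        (zeros , b₁-padded false (≈-sym (⊕-cong [ true ] (++-gap-⊕-zeros (t true s) s q gap≡))))
        (zeros , b₁-padded true (λ i → cong (λ w → ([ true ] ⊕ (w ⊕ zeros)) i) (t-∷ʳ true s q)))
        where
        open SetoidReasoning Cantor-setoid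
        b₁-padded : ∀ ε {x} → x ≈ ([ true ] ⊕ ((t true s ++ (gap s q ++ [ ε ])) ⊕ zeros)) →
                    x ≈ (((true ∷ t true s ++ gap s q) ++ [ ε ]) ⊕ zeros)
        b₁-padded ε {x} x≈ = begin
          x                                                        ≈⟨ x≈ ⟩
          [ true ] ⊕ ((t true s ++ (gap s q ++ [ ε ])) ⊕ zeros)    ≈⟨ ⊕-++ [ true ] _ zeros ⟨
          (true ∷ t true s ++ (gap s q ++ [ ε ])) ⊕ zeros          ≡⟨ cong (λ w → (true ∷ w) ⊕ zeros) (++-assoc (t true s) (gap s q) [ ε ]) ⟨
          ((true ∷ t true s ++ gap s q) ++ [ ε ]) ⊕ zeros          ∎

      record Extension (s : List ℕ) (b : Ord) (m : ℕ) : Set where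
        field
          q         : ℕ
          a         : Ord
          label     : φ cof η (s ∷ʳ q) ≡ just a
          b≤a       : b ≤ₒ a
          allZero   : AllZero (s ∷ʳ q)
          b₁-agree  : Agree m (b₁ s) (b₁ (s ∷ʳ q))
          b₁-differ : ¬ b₁ s ≈ b₁ (s ∷ʳ q)

      extension : ∀ s {a b} → φ cof η s ≡ just a → AllZero s → b <ₒ a → ∀ m → Extension s b m
      extension s {a} {b} φs≡a zeros≈ b<a m with φstep-eventually-≥ a b (φ-wf s φs≡a) b<a
      ... | n₀ , eventually with ψ-replicate (m + n₀)
      ... | q , m+n₀≤q , ψq≡ with eventually q (≤-trans (m≤n+m n₀ m) m+n₀≤q) | gap-replicate s q (m + n₀) ψq≡
      ... | a' , step , b≤a' | n , m+n₀≤n , gap≡ = record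
        { q         = q
        ; a         = a'
        ; label     = trans (φ-∷ʳ s q) (trans (cong (λ φs → φstep cof φs q) φs≡a) step)
        ; b≤a       = b≤a'
        ; allZero   = AllZero-∷ʳ s q gap≡ zeros≈
        ; b₁-agree  = Agree-≤ m≤length (Diverge.agree b₁-diverge)
        ; b₁-differ = λ b₁≈ → Diverge.differ b₁-diverge (b₁≈ _)
        }
        where
        b₁-diverge = b₁-Diverge s q gap≡
        m≤length : m ≤ length (true ∷ t true s ++ gap s q)
        m≤length = begin
          m                                      ≤⟨ m≤m+n m n₀ ⟩
          m + n₀                                 ≤⟨ m+n₀≤n ⟩
          n                                      ≡⟨ length-replicate n ⟨
          length (replicate n false)             ≡⟨ cong length gap≡ ⟨
          length (gap s q)                       ≤⟨ m≤n+m _ (length (t true s)) ⟩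
          length (t true s) + length (gap s q)   ≡⟨ length-++ (t true s) ⟨
          length (t true s ++ gap s q)           ≤⟨ n≤1+n _ ⟩
          length (true ∷ t true s ++ gap s q)    ∎
          where open ≤-Reasoning

      module _ (f : Cantor → Cantor) (f-continuous : Continuous f) (f-injective : InjectiveC f)
               (f-reduces : ∀ ε x y → BB cof η code ε x y → NN cof η code ε (f x) (f y)) where

        Witness : List ℕ → Set
        Witness s = ∃ λ R → ∃ λ δ → InT cof η R × f b₀ ≈ (t false R ⊕ δ) × f (b₁ s) ≈ (t true R ⊕ δ)

        witness : ∀ s → InT cof η s → AllZero s → Witness s
        witness s inT zeros≈ with parity (length s)
        ... | ε , |s|≡ε with f-reduces ε b₀ (b₁ s)
              (zeros , t true s ⊕ zeros , (s , inT , |s|≡ε , zeros , zeros≈ , λ _ → refl) , (λ _ → refl) , λ _ → refl)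
        ... | R , inT' , _ , δ , fb₀≈ , fb₁≈ = R , δ , inT' , fb₀≈ , fb₁≈

        witness-extends : ∀ s s' R R' {δ δ'} → InT cof η R → InT cof η R' →
          f b₀ ≈ (t false R ⊕ δ)   → f (b₁ s)  ≈ (t true R ⊕ δ) →
          f b₀ ≈ (t false R' ⊕ δ') → f (b₁ s') ≈ (t true R' ⊕ δ') →
          Agree (length (t true R)) (f (b₁ s)) (f (b₁ s')) → ¬ b₁ s ≈ b₁ s' →
          ∃ λ c → ∃ λ M → R' ≡ R ++ c ∷ M
        witness-extends s s' R R' {δ} {δ'} inT inT' fb₀≈ fb₁≈ fb₀≈' fb₁≈' agree b₁≉
          with t-prefix R {R'} inT inT' (δ , fb₀≈) (δ , fb₁≈) fb₀≈' fb₁≈' agree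
        ... | c ∷ M , R'≡ = c , M , R'≡
        ... | [] , R'≡R++[] = contradiction (f-injective (b₁ s) (b₁ s')
                (≈-trans fb₁≈ (≈-trans (⊕-cong (t true R) (⊕-cancel (t false R) fb₀≈ fb₀≈'')) (≈-sym fb₁≈'')))) b₁≉
          where
          R'≡R = trans R'≡R++[] (++-identityʳ R)
          fb₀≈'' = subst (λ r → f b₀ ≈ (t false r ⊕ δ')) R'≡R fb₀≈'
          fb₁≈'' = subst (λ r → f (b₁ s') ≈ (t true r ⊕ δ')) R'≡R fb₁≈'

        record Stage (b : Ord) : Set where
          field
            s        : List ℕ
            a        : Ord
            label-s  : φ cof η s ≡ just a
            allZero  : AllZero s
            b<a      : b <ₒ a
            R        : List ℕ
            δ        : Cantor
            label-R  : φ cof η R ≡ just b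
            fb₀≈     : f b₀ ≈ (t false R ⊕ δ)
            fb₁≈     : f (b₁ s) ≈ (t true R ⊕ δ)

        initial-stage : ∃ Stage
        initial-stage with witness [] (λ ()) (λ _ → refl)
        ... | [] , δ , _ , fb₀≈ , fb₁≈ = contradiction (f-injective b₀ (b₁ []) (≈-trans fb₀≈ (≈-sym fb₁≈)) 0) λ ()
        ... | c ∷ M , δ , inT , fb₀≈ , fb₁≈ with InT-label (c ∷ M) inT
        ... | b , label = b , record
          { s = [] ; a = η ; label-s = refl ; allZero = λ _ → refl ; b<a = φ-++-< [] c M refl label
          ; R = c ∷ M ; δ = δ ; label-R = label ; fb₀≈ = fb₀≈ ; fb₁≈ = fb₁≈ }

        next-stage : ∀ {b} → Stage b → ∃ λ b' → b' <ₒ b × Stage b'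
        next-stage {b} record { s = s ; label-s = label-s ; allZero = zeros≈ ; b<a = b<a
                              ; R = R ; δ = δ ; label-R = label-R ; fb₀≈ = fb₀≈ ; fb₁≈ = fb₁≈ }
          with f-continuous (b₁ s) (length (t true R))
        ... | m , f-agree with extension s label-s zeros≈ b<a m
        ... | record { q = q ; a = a' ; label = label' ; b≤a = b≤a' ; allZero = zeros≈'
                     ; b₁-agree = b₁-agree ; b₁-differ = b₁-differ }
          with witness (s ∷ʳ q) (label⇒InT (s ∷ʳ q) label') zeros≈'
        ... | R' , δ' , inT' , fb₀≈' , fb₁≈'
          with witness-extends s (s ∷ʳ q) R R' (label⇒InT R label-R) inT' fb₀≈ fb₁≈ fb₀≈' fb₁≈'
                 (f-agree (b₁ (s ∷ʳ q)) b₁-agree) b₁-differ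
             | InT-label R' inT'
        ... | c , M , R'≡ | b' , label-R' = b' , b'<b , record
          { s = s ∷ʳ q ; a = a' ; label-s = label' ; allZero = zeros≈' ; b<a = <ₒ-≤ₒ-trans b' b a' b'<b b≤a'
          ; R = R' ; δ = δ' ; label-R = label-R' ; fb₀≈ = fb₀≈' ; fb₁≈ = fb₁≈' }
          where
          b'<b : b' <ₒ b
          b'<b = φ-++-< R c M label-R (subst (λ r → φ cof η r ≡ just b') R'≡ label-R')

        no-stage : ∀ b → Acc _<ₒ_ b → ¬ Stage b
        no-stage b (acc below) stage = descend (next-stage stage)
          where
          descend : ∃ (λ b' → b' <ₒ b × Stage b') → ⊥
          descend (b' , b'<b , stage') = no-stage b' (below b'<b) stage'

        no-reduction : ⊥
        no-reduction with initial-stage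
        ... | b , stage = no-stage b (<ₒ-wellFounded b) stage

      B⋢N : ¬ SquareRed (BB cof η code false) (BB cof η code true) (NN cof η code false) (NN cof η code true)
      B⋢N (f , f-continuous , f-injective , f-reduces₀ , f-reduces₁) =
        no-reduction f f-continuous f-injective λ { false → f-reduces₀ ; true → f-reduces₁ }

¬BB-diagonal : ∀ {cof η code} ε x → ¬ BB cof η code ε x x
¬BB-diagonal ε x (_ , _ , _ , x≈0α , x≈1β) with trans (sym (x≈0α 0)) (x≈1β 0)
... | ()

N⋢B : ∀ cof η code → ¬ SquareRed (NN cof η code false) (NN cof η code true) (BB cof η code false) (BB cof η code true)
N⋢B cof η code (f , _ , _ , f-reduces , _) = ¬BB-diagonal false (f zeros)
  (f-reduces zeros zeros ([] , (λ ()) , refl , zeros , (λ _ → refl) , λ _ → refl))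

proposition3p4 : (η : Ord) → WF η → os oz ≤ₒ η →
    (p : ℕ → ℕ) → PrimeEnum p →
    (cof : (ℕ → Ord) → ℕ → Ord) → CofChoice cof →
    (code : List ℕ → ℕ) → IsCode p cof η code →
    ¬ SquareRed (NN cof η code false) (NN cof η code true)
                (BB cof η code false) (BB cof η code true)
    × ¬ SquareRed (BB cof η code false) (BB cof η code true)
                  (NN cof η code false) (NN cof η code true)
proposition3p4 η wη _ p pe cof cc code ic = N⋢B cof η code , B⋢N cc wη pe ic
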